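{- $\mathbf{K_N^{Krom}} \prec^w \mathbf{K_N^{Bool}}$, i.e. $\mathbf{K_N^{Krom}}$ is weakly less expressive than $\mathbf{K_N^{Bool}}$ over the class of all Kripke frames.
   Context: Fix a finite set $\tau=\{\alpha_1,\dots,\alpha_N\}$ of modality labels and a countable set $\mathcal P$ of propositional letters. Formulas of $\mathbf{K_N}$ (also written $\mathbf{K_N^{Bool}}$) are generated by $\varphi ::= \top \mid p \mid \neg\varphi \mid \varphi\vee\varphi \mid \Diamond_\alpha\varphi \mid \Box_\alpha\varphi$ ($p\in\mathcal P$, $\alpha\in\tau$); $\wedge,\rightarrow$ are abbreviations and $\bot=\neg\top$. A model $M=(W,\{R_\alpha\}_{\alpha\in\tau},V)$ has a nonempty set $W$, relations $R_\alpha\subseteq W\times W$, and valuation $V:W\to 2^{\mathcal P}$; satisfaction $M,w\Vdash\varphi$ is the standard Kripke semantics. Positive literals: $\lambda ::= \top \mid p \mid \Diamond_\alpha\lambda \mid \Box_\alpha\lambda$. A formula is in clausal form if generated by $\varphi ::= \lambda \mid \neg\lambda \mid \nabla(\neg\lambda_1\vee\dots\vee\neg\lambda_n\vee\lambda_{n+1}\vee\dots\vee\lambda_{n+m}) \mid \varphi\wedge\varphi$, where the $\lambda,\lambda_i$ are positive literals and $\nabla$ is a finite (possibly empty) sequence of boxes $\Box_{\alpha_i}\Box_{\alpha_j}\cdots$. $\mathbf{K_N^{Krom}}$ consists of clausal-form formulas in which every clause has $n+m\le 2$. Expressivity (over all Kripke frames): $\mathbf L\preceq^w\mathbf L'$ if,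 for a fixed alphabet $\mathcal P$, there is an effective translation $\varphi\mapsto\varphi'$ from $\mathbf L$-formulas over $\mathcal P$ to $\mathbf L'$-formulas over the same $\mathcal P$ such that for every model $M$ and world $w$, $M,w\Vdash\varphi$ iff $M,w\Vdash\varphi'$. $\mathbf L\equiv^w\mathbf L'$ means both $\mathbf L\preceq^w\mathbf L'$ and $\mathbf L'\preceq^w\mathbf L$; $\mathbf L\prec^w\mathbf L'$ means $\mathbf L\preceq^w\mathbf L'$ and not $\mathbf L\equiv^w\mathbf L'$. -}

module Defs where

open import Data.Nat using (ℕ)
open import Data.Fin using (Fin)
open import Data.Product using (Σ; _×_)
open import Data.Sum using (_⊎_)
open import Data.Unit using (⊤)
open import Data.Empty using (⊥)
open import Relation.Nullary using (¬_)
open import Function.Bundles using (_⇔_)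

Prop : Set
Prop = ℕ

-- Modality labels τ = {α₁,…,α_N} represented by Fin N.
module _ (N : ℕ) where

  data Form : Set where
    ⊤̇   : Form
    var  : Prop → Form
    ¬̇_   : Form → Form
    _∨̇_  : Form → Form → Form
    ◇    : Fin N → Form → Form
    □    : Fin N → Form → Form

module _ {N : ℕ} where

  ⊥̇ : Form N
  ⊥̇ = ¬̇ ⊤̇

  _∧̇_ : Form N → Form N → Form N
  φ ∧̇ ψ = ¬̇ ((¬̇ φ) ∨̇ (¬̇ ψ))

  _→̇_ : Form N → Form N → Form N
  φ →̇ ψ = (¬̇ φ) ∨̇ ψ

record Model (N : ℕ) : Set₁ where
  field
    W        : Set
    inhabited : W
    R        : Fin N → W → W → Set
    V        : W → Prop → Set

open Model public

_,_⊩_ : {N : ℕ} (M : Model N) → W M → Form N → Set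
M , w ⊩ ⊤̇       = ⊤
M , w ⊩ var p    = V M w p
M , w ⊩ (¬̇ φ)    = ¬ (M , w ⊩ φ)
M , w ⊩ (φ ∨̇ ψ)  = (M , w ⊩ φ) ⊎ (M , w ⊩ ψ)
M , w ⊩ ◇ a φ    = Σ (W M) λ v → R M a w v × (M , v ⊩ φ)
M , w ⊩ □ a φ    = (v : W M) → R M a w v → M , v ⊩ φ

-- A "logic" (fragment) is a class of K_N formulas.
Logic : ℕ → Set₁
Logic N = Form N → Set

module _ {N : ℕ} where

  data PosLit : Form N → Set where
    pl-⊤ : PosLit ⊤̇
    pl-p : ∀ p → PosLit (var p)
    pl-◇ : ∀ a {φ} → PosLit φ → PosLit (◇ a φ)
    pl-□ : ∀ a {φ} → PosLit φ → PosLit (□ a φ)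

  -- Krom clauses ¬λ₁ ∨ … ∨ ¬λₙ ∨ λₙ₊₁ ∨ … ∨ λₙ₊ₘ with n + m ≤ 2
  -- (the empty clause n+m=0 is ⊥ = ¬⊤, already a one-literal clause)
  data KromClause : Form N → Set where
    kc-pos    : ∀ {l} → PosLit l → KromClause l
    kc-neg    : ∀ {l} → PosLit l → KromClause (¬̇ l)
    kc-negneg : ∀ {l l'} → PosLit l → PosLit l' → KromClause ((¬̇ l) ∨̇ (¬̇ l'))
    kc-negpos : ∀ {l l'} → PosLit l → PosLit l' → KromClause ((¬̇ l) ∨̇ l')
    kc-pospos : ∀ {l l'} → PosLit l → PosLit l' → KromClause (l ∨̇ l')

  data BoxedKromClause : Form N → Set where
    bk-base : ∀ {φ} → KromClause φ → BoxedKromClause φ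
    bk-□    : ∀ a {φ} → BoxedKromClause φ → BoxedKromClause (□ a φ)

  data Krom : Form N → Set where
    k-pos  : ∀ {l} → PosLit l → Krom l
    k-neg  : ∀ {l} → PosLit l → Krom (¬̇ l)
    k-cl   : ∀ {φ} → BoxedKromClause φ → Krom φ
    k-and  : ∀ {φ ψ} → Krom φ → Krom ψ → Krom (φ ∧̇ ψ)

KBool : (N : ℕ) → Logic N
KBool N _ = ⊤

KKrom : (N : ℕ) → Logic N
KKrom N = Krom

-- Weak expressivity L ⪯ʷ L' : a (computable, i.e. Agda-definable) translation
-- from L-formulas to L'-formulas over the same alphabet, preserving truth at
-- every world of every model.
_⪯ʷ_ : {N : ℕ} → Logic N → Logic N → Set₁
_⪯ʷ_ {N} L L' =
  Σ (Σ (Form N) L → Σ (Form N) L') λ tr →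
    (φ : Σ (Form N) L) (M : Model N) (w : W M) →
      (M , w ⊩ Σ.proj₁ φ) ⇔ (M , w ⊩ Σ.proj₁ (tr φ))

_≡ʷ_ : {N : ℕ} → Logic N → Logic N → Set₁
L ≡ʷ L' = (L ⪯ʷ L') × (L' ⪯ʷ L)

_≺ʷ_ : {N : ℕ} → Logic N → Logic N → Set₁
L ≺ʷ L' = (L ⪯ʷ L') × ¬ (L ≡ʷ L')

-- Krom formulas cannot express the three-letter disjunction p₁ ∨ p₂ ∨ p₃.
-- At a single world without successors every box is true and every
-- diamond false, so a formula is evaluated there as a Boolean function of
-- the valuation.  Each positive or negated literal then commutes with the
-- pointwise majority of three valuations, a clause of at most two literals
-- is preserved by it (two of the three valuations satisfy the same
-- literal), and so is a conjunction.  The valuations {p₁}, {p₂}, {p₃}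
-- satisfy p₁ ∨ p₂ ∨ p₃, but their majority is the empty valuation.
module Submission where

open import Data.Bool using (Bool; true; false; not; _∧_; _∨_; T)
open import Data.Bool.Properties using (T-∨)
open import Data.Empty using (⊥)
open import Data.Nat using (ℕ; _≡ᵇ_)
open import Data.Product using (_×_; _,_; proj₁; proj₂)
open import Data.Sum using (_⊎_; inj₁; inj₂)
open import Data.Sum.Function.Propositional using (_⊎-⇔_)
open import Data.Unit using (⊤; tt)
open import Function using (const; id)
open import Function.Bundles using (_⇔_; mk⇔; Equivalence)
open import Function.Properties.Equivalence using () renaming (trans to ⇔-trans; sym to ⇔-sym)
open import Function.Related.TypeIsomorphisms using (¬-cong-⇔)
open import Relation.Binary.PropositionalEquality using (_≡_; refl; sym; cong; cong₂; subst; module ≡-Reasoning)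
open import Relation.Nullary using (¬_)
open import Defs

Valuation : Set
Valuation = Prop → Bool

majority : Bool → Bool → Bool → Bool
majority true  y z = y ∨ z
majority false y z = y ∧ z

not-majority : ∀ x y z → not (majority x y z) ≡ majority (not x) (not y) (not z)
not-majority true  true  _     = refl
not-majority true  false z     = refl
not-majority false true  z     = refl
not-majority false false true  = refl
not-majority false false false = refl

majority-true₁₂ : ∀ x y z → T x → T y → T (majority x y z)
majority-true₁₂ true true _ _ _ = tt

majority-true₁₃ : ∀ x y z → T x → T z → T (majority x y z)
majority-true₁₃ true true  _    _ _ = tt
majority-true₁₃ true false true _ _ = tt

majority-true₂₃ : ∀ x y z → T y → T z → T (majority x y z)
majority-true₂₃ true  true true _ _ = tt
majority-true₂₃ false true true _ _ = tt

majority-∨ : ∀ x₁ x₂ x₃ y₁ y₂ y₃ →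
             T (x₁ ∨ y₁) → T (x₂ ∨ y₂) → T (x₃ ∨ y₃) →
             T (majority x₁ x₂ x₃ ∨ majority y₁ y₂ y₃)
majority-∨ x₁ x₂ x₃ y₁ y₂ y₃ h₁ h₂ h₃ =
  Equivalence.from T-∨ (pick (to h₁) (to h₂) (to h₃))
  where
  to : ∀ {x y} → T (x ∨ y) → T x ⊎ T y
  to = Equivalence.to T-∨

  pick : T x₁ ⊎ T y₁ → T x₂ ⊎ T y₂ → T x₃ ⊎ T y₃ →
         T (majority x₁ x₂ x₃) ⊎ T (majority y₁ y₂ y₃)
  pick (inj₁ a) (inj₁ b) _        = inj₁ (majority-true₁₂ x₁ x₂ x₃ a b)
  pick (inj₁ a) (inj₂ _) (inj₁ c) = inj₁ (majority-true₁₃ x₁ x₂ x₃ a c)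
  pick (inj₁ _) (inj₂ b) (inj₂ c) = inj₂ (majority-true₂₃ y₁ y₂ y₃ b c)
  pick (inj₂ _) (inj₁ b) (inj₁ c) = inj₁ (majority-true₂₃ x₁ x₂ x₃ b c)
  pick (inj₂ a) (inj₁ _) (inj₂ c) = inj₂ (majority-true₁₃ y₁ y₂ y₃ a c)
  pick (inj₂ a) (inj₂ b) _        = inj₂ (majority-true₁₂ y₁ y₂ y₃ a b)

majorityᵛ : Valuation → Valuation → Valuation → Valuation
majorityᵛ u v w p = majority (u p) (v p) (w p)

T-not-∨-not : ∀ {x y} → T (not (not x ∨ not y)) ⇔ (T x × T y)
T-not-∨-not {true}  {true}  = mk⇔ (const (tt , tt)) (const tt)
T-not-∨-not {true}  {false} = mk⇔ (λ ()) proj₂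
T-not-∨-not {false} {_}     = mk⇔ (λ ()) proj₁

¬T⇔T-not : ∀ b → (¬ T b) ⇔ T (not b)
¬T⇔T-not true  = mk⇔ (λ ¬t → ¬t tt) (λ ())
¬T⇔T-not false = mk⇔ (const tt) (const id)

module _ {N : ℕ} where

  deadPoint : Valuation → Model N
  deadPoint v = record
    { W = ⊤ ; inhabited = tt ; R = λ _ _ _ → ⊥ ; V = λ _ p → T (v p) }

  evalDead : Valuation → Form N → Bool
  evalDead v ⊤̇       = true
  evalDead v (var p)  = v p
  evalDead v (¬̇ φ)    = not (evalDead v φ)
  evalDead v (φ ∨̇ ψ)  = evalDead v φ ∨ evalDead v ψ
  evalDead v (◇ _ _)  = false
  evalDead v (□ _ _)  = true

  deadPoint-⊩ : ∀ v φ → (deadPoint v , tt ⊩ φ) ⇔ T (evalDead v φ)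
  deadPoint-⊩ v ⊤̇       = mk⇔ id id
  deadPoint-⊩ v (var p)  = mk⇔ id id
  deadPoint-⊩ v (¬̇ φ)    = ⇔-trans (¬-cong-⇔ (deadPoint-⊩ v φ)) (¬T⇔T-not (evalDead v φ))
  deadPoint-⊩ v (φ ∨̇ ψ)  = ⇔-trans (deadPoint-⊩ v φ ⊎-⇔ deadPoint-⊩ v ψ) (⇔-sym T-∨)
  deadPoint-⊩ v (◇ _ _)  = mk⇔ (λ { (_ , () , _) }) (λ ())
  deadPoint-⊩ v (□ _ _)  = mk⇔ (const tt) (λ _ _ ())

  record CommutesWithMajority (φ : Form N) : Set where
    constructor commutesWithMajority
    field
      evalDead-majorityᵛ : ∀ u v w →
        evalDead (majorityᵛ u v w) φ ≡ majority (evalDead u φ) (evalDead v φ) (evalDead w φ)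

  record PreservedByMajority (φ : Form N) : Set where
    constructor preservedByMajority
    field
      preserved : ∀ u v w → T (evalDead u φ) → T (evalDead v φ) → T (evalDead w φ) →
                  T (evalDead (majorityᵛ u v w) φ)

  open CommutesWithMajority
  open PreservedByMajority

  PosLit-commutesWithMajority : ∀ {l} → PosLit l → CommutesWithMajority l
  PosLit-commutesWithMajority pl-⊤       = commutesWithMajority λ _ _ _ → refl
  PosLit-commutesWithMajority (pl-p _)   = commutesWithMajority λ _ _ _ → refl
  PosLit-commutesWithMajority (pl-◇ _ _) = commutesWithMajority λ _ _ _ → refl
  PosLit-commutesWithMajority (pl-□ _ _) = commutesWithMajority λ _ _ _ → refl

  ¬̇-commutesWithMajority : ∀ {φ} → CommutesWithMajority φ → CommutesWithMajority (¬̇ φ)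
  ¬̇-commutesWithMajority {φ} c = commutesWithMajority λ u v w → begin
    not (evalDead (majorityᵛ u v w) φ)
      ≡⟨ cong not (evalDead-majorityᵛ c u v w) ⟩
    not (majority (evalDead u φ) (evalDead v φ) (evalDead w φ))
      ≡⟨ not-majority (evalDead u φ) (evalDead v φ) (evalDead w φ) ⟩
    majority (not (evalDead u φ)) (not (evalDead v φ)) (not (evalDead w φ))
      ∎
    where open ≡-Reasoning

  commutes⇒preserved : ∀ {φ} → CommutesWithMajority φ → PreservedByMajority φ
  commutes⇒preserved c = preservedByMajority λ u v w tu tv _ →
    subst T (sym (evalDead-majorityᵛ c u v w)) (majority-true₁₂ _ _ _ tu tv)

  ∨̇-preserved : ∀ {φ ψ} → CommutesWithMajority φ → CommutesWithMajority ψ →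
                PreservedByMajority (φ ∨̇ ψ)
  ∨̇-preserved {φ} {ψ} cφ cψ = preservedByMajority λ u v w tu tv tw →
    subst T (sym (cong₂ _∨_ (evalDead-majorityᵛ cφ u v w) (evalDead-majorityᵛ cψ u v w)))
      (majority-∨ (evalDead u φ) (evalDead v φ) (evalDead w φ)
                  (evalDead u ψ) (evalDead v ψ) (evalDead w ψ) tu tv tw)

  ∧̇-preserved : ∀ {φ ψ} → PreservedByMajority φ → PreservedByMajority ψ →
                PreservedByMajority (φ ∧̇ ψ)
  ∧̇-preserved pφ pψ = preservedByMajority λ u v w tu tv tw →
    Equivalence.from T-not-∨-not
      ( preserved pφ u v w (proj₁ (split tu)) (proj₁ (split tv)) (proj₁ (split tw))
      , preserved pψ u v w (proj₂ (split tu)) (proj₂ (split tv)) (proj₂ (split tw)) )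
    where
    split : ∀ {x y} → T (not (not x ∨ not y)) → T x × T y
    split = Equivalence.to T-not-∨-not

  BoxedKromClause-preserved : ∀ {φ} → BoxedKromClause φ → PreservedByMajority φ
  BoxedKromClause-preserved (bk-□ _ _) = preservedByMajority λ _ _ _ _ _ _ → tt
  BoxedKromClause-preserved (bk-base (kc-pos l)) =
    commutes⇒preserved (PosLit-commutesWithMajority l)
  BoxedKromClause-preserved (bk-base (kc-neg l)) =
    commutes⇒preserved (¬̇-commutesWithMajority (PosLit-commutesWithMajority l))
  BoxedKromClause-preserved (bk-base (kc-negneg l l')) =
    ∨̇-preserved (¬̇-commutesWithMajority (PosLit-commutesWithMajority l))
                (¬̇-commutesWithMajority (PosLit-commutesWithMajority l'))
  BoxedKromClause-preserved (bk-base (kc-negpos l l')) =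
    ∨̇-preserved (¬̇-commutesWithMajority (PosLit-commutesWithMajority l))
                (PosLit-commutesWithMajority l')
  BoxedKromClause-preserved (bk-base (kc-pospos l l')) =
    ∨̇-preserved (PosLit-commutesWithMajority l) (PosLit-commutesWithMajority l')

  Krom-preserved : ∀ {φ} → Krom φ → PreservedByMajority φ
  Krom-preserved (k-pos l)   = BoxedKromClause-preserved (bk-base (kc-pos l))
  Krom-preserved (k-neg l)   = BoxedKromClause-preserved (bk-base (kc-neg l))
  Krom-preserved (k-cl c)    = BoxedKromClause-preserved c
  Krom-preserved (k-and k k') = ∧̇-preserved (Krom-preserved k) (Krom-preserved k')

  disjunction₃ : Form N
  disjunction₃ = (var 1 ∨̇ var 2) ∨̇ var 3

  singleton : Prop → Valuation
  singleton p q = q ≡ᵇ p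

  disjunction₃-notKromDefinable : ∀ {ψ} → Krom ψ →
    ¬ (∀ (M : Model N) w → (M , w ⊩ disjunction₃) ⇔ (M , w ⊩ ψ))
  disjunction₃-notKromDefinable {ψ} kψ equiv =
    Equivalence.from (dead⇔ (majorityᵛ (singleton 1) (singleton 2) (singleton 3)))
      (preserved (Krom-preserved kψ) (singleton 1) (singleton 2) (singleton 3)
        (Equivalence.to (dead⇔ (singleton 1)) tt)
        (Equivalence.to (dead⇔ (singleton 2)) tt)
        (Equivalence.to (dead⇔ (singleton 3)) tt))
    where
    dead⇔ : ∀ v → T (evalDead v disjunction₃) ⇔ T (evalDead v ψ)
    dead⇔ v = ⇔-trans (⇔-sym (deadPoint-⊩ v disjunction₃))
                      (⇔-trans (equiv (deadPoint v) tt) (deadPoint-⊩ v ψ))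

  ⊆⇒⪯ʷ : {L L' : Logic N} → (∀ {φ} → L φ → L' φ) → L ⪯ʷ L'
  ⊆⇒⪯ʷ L⊆L' = (λ { (φ , lφ) → φ , L⊆L' lφ }) , λ _ _ _ → mk⇔ id id

theorem2 : (N : ℕ) → KKrom N ≺ʷ KBool N
theorem2 N = ⊆⇒⪯ʷ (const tt) , λ { (_ , (tr , equiv)) →
  disjunction₃-notKromDefinable (proj₂ (tr (disjunction₃ , tt))) (equiv (disjunction₃ , tt)) }
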